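{- Let $n\ge 1$, let $T=(V,E)$ be a tree on $2n$ vertices, and let $v\in V$ have degree $n$ in $T$. If the chromatic symmetric function $X_T(\mathbf{x})$ is Schur positive, then every vertex $x\in V$ that is neither $v$ nor a neighbor of $v$ is a leaf of $T$.
   Context: For a finite simple graph $G=(V,E)$, a proper coloring is a function $\kappa:V\to\mathbb{P}$ (positive integers) with $\kappa(v)\neq\kappa(w)$ whenever $\{v,w\}\in E$. With commuting variables $\mathbf{x}=\{x_i: i\in\mathbb{P}\}$, the chromatic symmetric function is $X_G(\mathbf{x})=\sum_{\kappa}\prod_{v\in V}x_{\kappa(v)}$, the sum over all proper colorings $\kappa$ of $G$. A symmetric function is Schur positive if all coefficients in its expansion in the basis of Schur functions are nonnegative. -}

module Defs where

open import Data.Bool using (Bool; true; false; _∧_; not)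
open import Data.Nat using (ℕ; zero; suc; _+_; _*_; _≤_; _<ᵇ_; _≤ᵇ_; _≡ᵇ_)
open import Data.Fin using (Fin; toℕ)
import Data.Fin as Fin
open import Data.Fin.Properties using () renaming (_≟_ to _≟F_)
open import Data.List using (List; []; _∷_; [_]; _++_; length; map; concatMap; concat; foldr; filter; lookup; zip; and; head; last; take; upTo; allFin; applyUpTo)
open import Data.Nat.ListAction using (sum)
open import Data.List.Relation.Unary.Linked using (Linked)
open import Data.List.Relation.Unary.Unique.Propositional using (Unique)
open import Data.Vec using (Vec; toList) renaming ([] to []v; _∷_ to _∷v_)
import Data.Vec as Vec
open import Data.Product using (Σ; _×_; _,_; proj₁; proj₂)
open import Data.Maybe using (just)
open import Relation.Binary.PropositionalEquality using (_≡_)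
open import Relation.Nullary.Decidable using (⌊_⌋)

record Graph (m : ℕ) : Set where
  field
    adj    : Fin m → Fin m → Bool
    sym    : ∀ u w → adj u w ≡ adj w u
    irrefl : ∀ u → adj u u ≡ false
open Graph public

Edge : ∀ {m} → Graph m → Fin m → Fin m → Set
Edge G u w = adj G u w ≡ true

all : ∀ {A : Set} → (A → Bool) → List A → Bool
all p []       = true
all p (x ∷ xs) = p x ∧ all p xs

countB : ∀ {A : Set} → (A → Bool) → List A → ℕ
countB p []       = 0
countB p (x ∷ xs) with p x
... | true  = suc (countB p xs)
... | false = countB p xs

degree : ∀ {m} → Graph m → Fin m → ℕ
degree G v = countB (adj G v) (allFin _)

IsLeaf : ∀ {m} → Graph m → Fin m → Set
IsLeaf G x = degree G x ≡ 1

Connected : ∀ {m} → Graph m → Set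
Connected {m} G = ∀ (u w : Fin m) → Σ (List (Fin m)) λ xs →
  Linked (Edge G) xs × head xs ≡ just u × last xs ≡ just w

-- a cycle: at least 3 distinct vertices x₀,…,x_k, consecutive ones
-- adjacent and x_k adjacent to x₀
HasCycle : ∀ {m} → Graph m → Set
HasCycle {m} G = Σ (List (Fin m)) λ xs →
  3 ≤ length xs × Unique xs × Linked (Edge G) (xs ++ take 1 xs)

IsTree : ∀ {m} → Graph m → Set
IsTree G = Connected G × (HasCycle G → Data.Empty.⊥)
  where import Data.Empty

words : ∀ {A : Set} (m : ℕ) → List A → List (Vec A m)
words zero    xs = [ []v ]
words (suc m) xs = concatMap (λ x → map (x ∷v_) (words m xs)) xs

listsUpTo : ∀ {A : Set} (N : ℕ) → List A → List (List A)
listsUpTo N xs = concatMap (λ k → map toList (words k xs)) (upTo (suc N))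

weaklyDecr : List ℕ → Bool
weaklyDecr (a ∷ b ∷ xs) = (b ≤ᵇ a) ∧ weaklyDecr (b ∷ xs)
weaklyDecr _            = true

IsPartitionOfB : ℕ → List ℕ → Bool
IsPartitionOfB N μ = weaklyDecr μ ∧ all (λ k → 1 ≤ᵇ k) μ ∧ (sum μ ≡ᵇ N)

partitions : ℕ → List (List ℕ)
partitions N = filter (λ μ → IsPartitionOfB N μ Data.Bool.≟ true)
                      (listsUpTo N (applyUpTo suc N))
  where import Data.Bool

-- For a weak composition α = (α₁,…,α_ℓ), the coefficient of
-- x₁^α₁ ⋯ x_ℓ^α_ℓ in X_G is the number of proper colorings
-- κ : V → {1,…,ℓ} with |κ⁻¹(i)| = αᵢ for all i.

_≟ᵇ_ : ∀ {k} → Fin k → Fin k → Bool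
i ≟ᵇ j = ⌊ i ≟F j ⌋

properB : ∀ {m ℓ} → Graph m → Vec (Fin ℓ) m → Bool
properB {m} G κ = all (λ u → all (λ w →
  not (adj G u w) Data.Bool.∨ not (Vec.lookup κ u ≟ᵇ Vec.lookup κ w))
  (allFin m)) (allFin m)
  where import Data.Bool

hasContent : (α : List ℕ) → List (Fin (length α)) → Bool
hasContent α es = all (λ i → countB (λ e → e ≟ᵇ i) es ≡ᵇ lookup α i)
                      (allFin (length α))

coeffX : ∀ {m} → Graph m → List ℕ → ℕ
coeffX {m} G α = countB (λ κ → properB G κ ∧ hasContent α (toList κ))
                        (words m (allFin (length α)))

-- The coefficient of x₁^α₁ ⋯ x_ℓ^α_ℓ in s_μ is the number of
-- semistandard Young tableaux of shape μ and content α.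

fillings : ∀ {ℓ} → List ℕ → List (List (List (Fin ℓ)))
fillings []      = [ [] ]
fillings {ℓ} (k ∷ μ) =
  concatMap (λ r → map (toList r ∷_) (fillings μ)) (words k (allFin ℓ))

rowWeak : ∀ {ℓ} → List (Fin ℓ) → Bool
rowWeak (a ∷ b ∷ xs) = (toℕ a ≤ᵇ toℕ b) ∧ rowWeak (b ∷ xs)
rowWeak _            = true

-- columns strictly increase: each entry of the lower row is larger than
-- the entry above it (the lower row is never longer for shapes μ)
colStrict : ∀ {ℓ} → List (List (Fin ℓ)) → Bool
colStrict (r ∷ s ∷ rs) = all (λ p → toℕ (proj₁ p) <ᵇ toℕ (proj₂ p)) (zip r s)
                         ∧ colStrict (s ∷ rs)
colStrict _            = true

isSSYT : ∀ {ℓ} → List (List (Fin ℓ)) → Bool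
isSSYT T = all rowWeak T ∧ colStrict T

kostka : List ℕ → List ℕ → ℕ
kostka μ α = countB (λ T → isSSYT T ∧ hasContent α (concat T)) (fillings μ)

-- Schur positivity of X_G (G on N = m vertices, so X_G is homogeneous
-- of degree m): X_G = Σ_{μ ⊢ m} c_μ s_μ with all c_μ ≥ 0, stated as
-- equality of the coefficients of every monomial x^α.

schurSum : (List ℕ → ℕ) → ℕ → List ℕ → ℕ
schurSum c N α = sum (map (λ μ → c μ * kostka μ α) (partitions N))

SchurPositive : ∀ {m} → Graph m → Set
SchurPositive {m} G = Σ (List ℕ → ℕ) λ c →
  ∀ (α : List ℕ) → coeffX G α ≡ schurSum c m α

-- Trees are bipartite, so some proper 2-colouring exists and X_T
-- has a nonzero coefficient at some monomial x₁^a x₂^b.  Writing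
-- X_T = Σ c_μ s_μ with c_μ ≥ 0, some μ ⊢ 2n has c_μ > 0 and K_{μ,(a,b)} > 0,
-- so μ has at most two rows; for such μ also K_{μ,(n,n)} > 0, hence X_T has
-- a nonzero coefficient at x₁^n x₂^n: T has a proper 2-colouring with two
-- classes of size n.  The n neighbours of v fill the opposite class, so a
-- vertex x ∉ {v} ∪ N(v) has the colour of v and all its neighbours are
-- neighbours of v; two of them would close a 4-cycle through v and x.
module Submission where

open import Defs hiding (sym)

open import Data.Bool using (Bool; true; false; _∧_; _∨_; not; T)
open import Data.Bool.Properties using (∧-conicalˡ; ∧-conicalʳ) renaming (_≟_ to _≟𝔹_)
open import Data.Empty using (⊥; ⊥-elim)
open import Data.Fin using (Fin; zero; suc; toℕ)
open import Data.Fin.Properties using () renaming (_≟_ to _≟F_)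
open import Data.List using (List; []; _∷_; [_]; _++_; length; map; concat; take; zip; replicate; allFin; tabulate; last; applyUpTo)
open import Data.List.Properties using (map-tabulate; length-++; length-replicate; ++-assoc; ++-identityʳ)
open import Data.List.Membership.Propositional using (_∈_; lose; find)
open import Data.List.Membership.Propositional.Properties
  using (∈-allFin; ∈-∃++; ∈-map⁺; ∈-map⁻; ∈-concatMap⁺; ∈-concatMap⁻; ∈-filter⁻)
open import Data.List.Relation.Unary.All using ([]; _∷_)
open import Data.List.Relation.Unary.All.Properties using (¬Any⇒All¬)
open import Data.List.Relation.Unary.AllPairs using ([]; _∷_)
open import Data.List.Relation.Unary.Any using (here; there)
open import Data.List.Relation.Unary.Linked using (Linked; []; [-]; _∷_)
open import Data.List.Relation.Unary.Unique.Propositional using (Unique)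
open import Data.Maybe using (just)
open import Data.Nat using (ℕ; zero; suc; _+_; _*_; _≤_; _<_; _∸_; z≤n; s≤s; _≡ᵇ_; _≤ᵇ_; _<ᵇ_; parity)
open import Data.Nat.Induction using (<-rec)
open import Data.Nat.ListAction using (sum)
open import Data.Nat.Properties
open import Data.Nat.Solver using (module +-*-Solver)
open import Data.Parity.Base using (Parity; 0ℙ; 1ℙ; _⁻¹) renaming (_+_ to _+ℙ_)
open import Data.Parity.Properties using (+-homo-+; suc-homo-⁻¹; ⁻¹-selfInverse; p+p⁻¹≡1ℙ)
open import Data.Product using (Σ; ∃; _×_; _,_; proj₁; proj₂)
open import Data.Sum using (_⊎_; inj₁; inj₂)
open import Data.Unit using (tt)
open import Data.Vec using (Vec; toList) renaming ([] to []ᵛ; _∷_ to _∷ᵛ_)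
import Data.Vec as Vec
open import Data.Vec.Properties using (lookup∘tabulate; length-toList; toList∘fromList)
open import Relation.Nullary using (yes; no)
open import Relation.Binary.PropositionalEquality
  using (_≡_; _≢_; refl; sym; trans; cong; cong₂; subst; subst₂; module ≡-Reasoning)

∧-intro : ∀ {a b} → a ≡ true → b ≡ true → a ∧ b ≡ true
∧-intro = cong₂ _∧_

fromTrue : ∀ {b} → b ≡ true → T b
fromTrue refl = tt

≡ᵇ-sound : ∀ {a b} → (a ≡ᵇ b) ≡ true → a ≡ b
≡ᵇ-sound {a} {b} e = ≡ᵇ⇒≡ a b (fromTrue e)

≡ᵇ-complete : ∀ {a b} → a ≡ b → (a ≡ᵇ b) ≡ true
≡ᵇ-complete {zero}  refl = refl
≡ᵇ-complete {suc a} refl = ≡ᵇ-complete {a} refl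

≤ᵇ-sound : ∀ {a b} → (a ≤ᵇ b) ≡ true → a ≤ b
≤ᵇ-sound {a} {b} e = ≤ᵇ⇒≤ a b (fromTrue e)

≟ᵇ-complete : ∀ {k} {i j : Fin k} → i ≡ j → (i ≟ᵇ j) ≡ true
≟ᵇ-complete {i = i} {j} i≡j with i ≟F j
... | yes _   = refl
... | no i≢j = ⊥-elim (i≢j i≡j)

≟ᵇ-false : ∀ {k} {i j : Fin k} → i ≢ j → (i ≟ᵇ j) ≡ false
≟ᵇ-false {i = i} {j} i≢j with i ≟F j
... | yes i≡j = ⊥-elim (i≢j i≡j)
... | no _    = refl

countB-pos : ∀ {A : Set} (p : A → Bool) {x xs} → x ∈ xs → p x ≡ true → 1 ≤ countB p xs
countB-pos p (here refl) px rewrite px = s≤s z≤n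
countB-pos p {xs = y ∷ ys} (there x∈ys) px with p y
... | true  = s≤s z≤n
... | false = countB-pos p x∈ys px

countB-pos⁻ : ∀ {A : Set} (p : A → Bool) xs → 1 ≤ countB p xs → ∃ λ x → x ∈ xs × p x ≡ true
countB-pos⁻ p (x ∷ xs) pos with p x in px
... | true  = x , here refl , px
... | false with countB-pos⁻ p xs pos
...   | y , y∈xs , py = y , there y∈xs , py

countB-mono : ∀ {A : Set} (p q : A → Bool) → (∀ x → p x ≡ true → q x ≡ true) →
  ∀ xs → countB p xs ≤ countB q xs
countB-mono p q p⇒q []       = z≤n
countB-mono p q p⇒q (x ∷ xs) with p x in px | q x in qx
... | true  | true  = s≤s (countB-mono p q p⇒q xs)
... | true  | false with () ← trans (sym qx) (p⇒q x px)
... | false | true  = m≤n⇒m≤1+n (countB-mono p q p⇒q xs)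
... | false | false = countB-mono p q p⇒q xs

countB-strict : ∀ {A : Set} (p q : A → Bool) → (∀ x → p x ≡ true → q x ≡ true) →
  ∀ xs {x} → x ∈ xs → p x ≡ false → q x ≡ true → countB p xs < countB q xs
countB-strict p q p⇒q (x ∷ xs) (here refl) px qx rewrite px | qx = s≤s (countB-mono p q p⇒q xs)
countB-strict p q p⇒q (y ∷ xs) (there x∈xs) px qx with p y in py | q y in qy
... | true  | true  = s≤s (countB-strict p q p⇒q xs x∈xs px qx)
... | true  | false with () ← trans (sym qy) (p⇒q y py)
... | false | true  = s≤s (countB-mono p q p⇒q xs)
... | false | false = countB-strict p q p⇒q xs x∈xs px qx

countB-≡-converse : ∀ {A : Set} (p q : A → Bool) → (∀ x → p x ≡ true → q x ≡ true) →
  ∀ xs → countB p xs ≡ countB q xs → ∀ {x} → x ∈ xs → q x ≡ true → p x ≡ true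
countB-≡-converse p q p⇒q xs same {x} x∈xs qx with p x in px
... | true  = refl
... | false = ⊥-elim (<-irrefl same (countB-strict p q p⇒q xs x∈xs px qx))

countB-ext : ∀ {A : Set} (p q : A → Bool) → (∀ x → p x ≡ q x) → ∀ xs → countB p xs ≡ countB q xs
countB-ext p q p≗q []       = refl
countB-ext p q p≗q (x ∷ xs) with p x | q x | p≗q x
... | true  | true  | _ = cong suc (countB-ext p q p≗q xs)
... | false | false | _ = countB-ext p q p≗q xs

countB-none : ∀ {A : Set} (p : A → Bool) → (∀ x → p x ≡ false) → ∀ xs → countB p xs ≡ 0
countB-none p never []       = refl
countB-none p never (x ∷ xs) rewrite never x = countB-none p never xs

countB-++ : ∀ {A : Set} (p : A → Bool) xs ys → countB p (xs ++ ys) ≡ countB p xs + countB p ys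
countB-++ p []       ys = refl
countB-++ p (x ∷ xs) ys with p x
... | true  = cong suc (countB-++ p xs ys)
... | false = countB-++ p xs ys

countB-map : ∀ {A B : Set} (p : B → Bool) (f : A → B) xs → countB p (map f xs) ≡ countB (λ x → p (f x)) xs
countB-map p f []       = refl
countB-map p f (x ∷ xs) with p (f x)
... | true  = cong suc (countB-map p f xs)
... | false = countB-map p f xs

countB-replicate-true : ∀ {A : Set} (p : A → Bool) {x} → p x ≡ true → ∀ k → countB p (replicate k x) ≡ k
countB-replicate-true p px zero    = refl
countB-replicate-true p px (suc k) rewrite px = cong suc (countB-replicate-true p px k)

countB-replicate-false : ∀ {A : Set} (p : A → Bool) {x} → p x ≡ false → ∀ k → countB p (replicate k x) ≡ 0
countB-replicate-false p px zero    = refl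
countB-replicate-false p px (suc k) rewrite px = countB-replicate-false p px k

countB-tabulate : ∀ {A : Set} {m} (p : A → Bool) (f : Fin m → A) →
  countB p (tabulate f) ≡ countB (λ i → p (f i)) (allFin m)
countB-tabulate p f = begin
  countB p (tabulate f)                 ≡⟨ cong (countB p) (sym (map-tabulate (λ i → i) f)) ⟩
  countB p (map f (allFin _))           ≡⟨ countB-map p f (allFin _) ⟩
  countB (λ i → p (f i)) (allFin _)     ∎
  where open ≡-Reasoning

countB-≟-allFin : ∀ {m} (y : Fin m) → countB (_≟ᵇ y) (allFin m) ≡ 1
countB-≟-allFin {suc m} zero = cong suc (trans (countB-tabulate (_≟ᵇ zero) (suc {m}))
                                              (countB-none (λ i → suc i ≟ᵇ zero) (λ _ → refl) (allFin m)))
countB-≟-allFin {suc m} (suc y) = begin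
  countB (_≟ᵇ suc y) (tabulate suc)          ≡⟨ countB-tabulate (_≟ᵇ suc y) suc ⟩
  countB (λ i → suc i ≟ᵇ suc y) (allFin m)   ≡⟨ countB-ext _ (_≟ᵇ y) (≟ᵇ-suc y) (allFin m) ⟩
  countB (_≟ᵇ y) (allFin m)                 ≡⟨ countB-≟-allFin y ⟩
  1                                          ∎
  where
    open ≡-Reasoning
    ≟ᵇ-suc : ∀ {m} (y x : Fin m) → (suc x ≟ᵇ suc y) ≡ (x ≟ᵇ y)
    ≟ᵇ-suc y x with x ≟F y
    ... | yes _ = refl
    ... | no _  = refl

countB-exactlyOne : ∀ {m} (p : Fin m → Bool) (y : Fin m) → (∀ z → p z ≡ true → z ≡ y) → p y ≡ true →
  countB p (allFin m) ≡ 1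
countB-exactlyOne p y onlyY py = trans (countB-ext p (_≟ᵇ y) agree (allFin _)) (countB-≟-allFin y)
  where
    agree : ∀ z → p z ≡ (z ≟ᵇ y)
    agree z with z ≟F y
    ... | yes refl = py
    ... | no z≢y with p z in pz
    ...   | true  = ⊥-elim (z≢y (onlyY z pz))
    ...   | false = refl

all-elim : ∀ {A : Set} (p : A → Bool) {x xs} → all p xs ≡ true → x ∈ xs → p x ≡ true
all-elim p {xs = y ∷ ys} ok (here refl)  = ∧-conicalˡ (p y) (all p ys) ok
all-elim p {xs = y ∷ ys} ok (there x∈ys) = all-elim p (∧-conicalʳ (p y) (all p ys) ok) x∈ys

all-intro : ∀ {A : Set} (p : A → Bool) xs → (∀ x → x ∈ xs → p x ≡ true) → all p xs ≡ true
all-intro p []       _  = refl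
all-intro p (x ∷ xs) ok = ∧-intro (ok x (here refl)) (all-intro p xs (λ y y∈xs → ok y (there y∈xs)))

sum-pos⁻ : ∀ {A : Set} (f : A → ℕ) xs → 1 ≤ sum (map f xs) → ∃ λ x → x ∈ xs × 1 ≤ f x
sum-pos⁻ f (x ∷ xs) pos with f x in fx
... | suc _ = x , here refl , subst (1 ≤_) (sym fx) (s≤s z≤n)
... | zero with sum-pos⁻ f xs pos
...   | y , y∈xs , fy = y , there y∈xs , fy

sum-pos : ∀ {A : Set} (f : A → ℕ) {x} xs → x ∈ xs → 1 ≤ f x → 1 ≤ sum (map f xs)
sum-pos f (y ∷ xs) (here refl)  fx = ≤-trans fx (m≤m+n (f y) _)
sum-pos f (y ∷ xs) (there x∈xs) fx = ≤-trans (sum-pos f xs x∈xs fx) (m≤n+m _ (f y))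

*-pos⁻ : ∀ a b → 1 ≤ a * b → 1 ≤ a × 1 ≤ b
*-pos⁻ (suc a) (suc b) _ = s≤s z≤n , s≤s z≤n
*-pos⁻ (suc a) zero    pos with () ← subst (1 ≤_) (*-zeroʳ (suc a)) pos

module _ {A : Set} {R : A → A → Set} where

  Linked-prefix : ∀ xs {y zs} → Linked R (xs ++ y ∷ zs) → Linked R (xs ++ [ y ])
  Linked-prefix []           _           = [-]
  Linked-prefix (x ∷ [])     (r ∷ _)     = r ∷ [-]
  Linked-prefix (x ∷ x′ ∷ xs) (r ∷ rest) = r ∷ Linked-prefix (x′ ∷ xs) rest

  Linked-suffix : ∀ xs {ys} → Linked R (xs ++ ys) → Linked R ys
  Linked-suffix []            l           = l
  Linked-suffix (x ∷ [])      [-]         = []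
  Linked-suffix (x ∷ [])      (_ ∷ rest)  = rest
  Linked-suffix (x ∷ x′ ∷ xs) (_ ∷ rest)  = Linked-suffix (x′ ∷ xs) rest

  Linked-glue : ∀ xs {y zs} → Linked R (xs ++ [ y ]) → Linked R (y ∷ zs) → Linked R (xs ++ y ∷ zs)
  Linked-glue []            _          l = l
  Linked-glue (x ∷ [])      (r ∷ _)    l = r ∷ l
  Linked-glue (x ∷ x′ ∷ xs) (r ∷ rest) l = r ∷ Linked-glue (x′ ∷ xs) rest l

module Walks {m} (G : Graph m) where

  edge-sym : ∀ {u w} → Edge G u w → Edge G w u
  edge-sym {u} {w} e = trans (Graph.sym G w u) e

  edge-distinct : ∀ {u w} → Edge G u w → u ≢ w
  edge-distinct {u} e refl with () ← trans (sym (Graph.irrefl G u)) e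

  data Walk : Fin m → Fin m → Set where
    done : ∀ {u} → Walk u u
    step : ∀ {u x w} → Edge G u x → Walk x w → Walk u w

  walkLength : ∀ {u w} → Walk u w → ℕ
  walkLength done       = 0
  walkLength (step _ p) = suc (walkLength p)

  _++ᵂ_ : ∀ {u x w} → Walk u x → Walk x w → Walk u w
  done     ++ᵂ q = q
  step e p ++ᵂ q = step e (p ++ᵂ q)

  ++ᵂ-length : ∀ {u x w} (p : Walk u x) (q : Walk x w) → walkLength (p ++ᵂ q) ≡ walkLength p + walkLength q
  ++ᵂ-length done       q = refl
  ++ᵂ-length (step e p) q = cong suc (++ᵂ-length p q)

  reverseᵂ : ∀ {u w} → Walk u w → Walk w u
  reverseᵂ done       = done
  reverseᵂ (step e p) = reverseᵂ p ++ᵂ step (edge-sym e) done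

  reverseᵂ-length : ∀ {u w} (p : Walk u w) → walkLength (reverseᵂ p) ≡ walkLength p
  reverseᵂ-length done       = refl
  reverseᵂ-length (step e p) = begin
    walkLength (reverseᵂ p ++ᵂ step (edge-sym e) done) ≡⟨ ++ᵂ-length (reverseᵂ p) _ ⟩
    walkLength (reverseᵂ p) + 1                        ≡⟨ +-comm (walkLength (reverseᵂ p)) 1 ⟩
    suc (walkLength (reverseᵂ p))                      ≡⟨ cong suc (reverseᵂ-length p) ⟩
    suc (walkLength p)                                 ∎
    where open ≡-Reasoning

  linkedWalk : ∀ {u w} ys → Linked (Edge G) (u ∷ ys) → last (u ∷ ys) ≡ just w → Walk u w
  linkedWalk []       _          refl = done
  linkedWalk (y ∷ ys) (e ∷ rest) ends = step e (linkedWalk ys rest ends)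

  connectingWalk : Connected G → ∀ u w → Walk u w
  connectingWalk conn u w with conn u w
  ... | _ ∷ ys , linked , refl , ends = linkedWalk ys linked ends

  -- A vertex other than v has a neighbour, namely the next vertex on a walk to v.
  connected-neighbour : Connected G → ∀ {x v} → x ≢ v → ∃ λ y → Edge G x y
  connected-neighbour conn {x} {v} x≢v with connectingWalk conn x v
  ... | done     = ⊥-elim (x≢v refl)
  ... | step e _ = _ , e

-- Odd closed walks contain cycles, so acyclic graphs have only even
-- closed walks.

odd-+⁻ : ∀ a b → parity (a + b) ≡ 1ℙ → parity a ≡ 1ℙ ⊎ parity b ≡ 1ℙ
odd-+⁻ a b odd with parity a | parity b | +-homo-+ a b
... | 1ℙ | _  | _     = inj₁ refl
... | 0ℙ | 1ℙ | _     = inj₂ refl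
... | 0ℙ | 0ℙ | split with () ← trans (sym odd) split

nonempty-length : ∀ {X : Set} (A : List X) {y : X} xs → 0 < length (A ++ y ∷ xs)
nonempty-length []      xs = s≤s z≤n
nonempty-length (_ ∷ A) xs = s≤s z≤n

take-one-++ : ∀ {X : Set} (A : List X) {y : X} xs ys → take 1 (A ++ y ∷ xs) ≡ take 1 (A ++ y ∷ ys)
take-one-++ []      xs ys = refl
take-one-++ (_ ∷ _) xs ys = refl

module OddCycles {m} (G : Graph m) where

  open Walks G
  open import Data.List.Membership.DecPropositional (_≟F_ {m}) using (_∈?_)

  Cyclic : List (Fin m) → Set
  Cyclic xs = Linked (Edge G) (xs ++ take 1 xs)

  -- The vertices of a walk, omitting the final one; for a closed walk
  -- they form a cyclic list of the same length.
  vertices : ∀ {u w} → Walk u w → List (Fin m)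
  vertices done              = []
  vertices (step {u} _ p)    = u ∷ vertices p

  vertices-length : ∀ {u w} (p : Walk u w) → length (vertices p) ≡ walkLength p
  vertices-length done       = refl
  vertices-length (step _ p) = cong suc (vertices-length p)

  vertices-linked : ∀ {u w} (p : Walk u w) → Linked (Edge G) (vertices p ++ [ w ])
  vertices-linked done                = [-]
  vertices-linked (step e done)       = e ∷ [-]
  vertices-linked (step e (step f p)) = e ∷ vertices-linked (step f p)

  closedWalk-cyclic : ∀ {u} (c : Walk u u) → Cyclic (vertices c)
  closedWalk-cyclic done       = []
  closedWalk-cyclic (step e p) = vertices-linked (step e p)

  Repetition : List (Fin m) → Set
  Repetition xs = ∃ λ A → ∃ λ y → ∃ λ B → ∃ λ C → xs ≡ A ++ y ∷ B ++ y ∷ C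

  unique-or-repetition : ∀ xs → Unique xs ⊎ Repetition xs
  unique-or-repetition []       = inj₁ []
  unique-or-repetition (x ∷ xs) with x ∈? xs
  ... | yes x∈xs with ∈-∃++ x∈xs
  ...   | B , C , xs≡ = inj₂ ([] , x , B , C , cong (x ∷_) xs≡)
  unique-or-repetition (x ∷ xs) | no x∉xs with unique-or-repetition xs
  ...   | inj₁ unique = inj₁ (¬Any⇒All¬ xs x∉xs ∷ unique)
  ...   | inj₂ (A , y , B , C , xs≡) = inj₂ (x ∷ A , y , B , C , cong (x ∷_) xs≡)

  module _ (A : List (Fin m)) (y : Fin m) (B C : List (Fin m)) where

    private
      t : List (Fin m)
      t = take 1 (A ++ y ∷ B ++ y ∷ C)

      reassociated : Cyclic (A ++ y ∷ B ++ y ∷ C) → Linked (Edge G) (A ++ y ∷ B ++ y ∷ (C ++ t))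
      reassociated = subst (Linked (Edge G))
        (trans (++-assoc A (y ∷ B ++ y ∷ C) t) (cong (λ z → A ++ y ∷ z) (++-assoc B (y ∷ C) t)))

    cyclic-inner : Cyclic (A ++ y ∷ B ++ y ∷ C) → Cyclic (y ∷ B)
    cyclic-inner cyc = Linked-prefix (y ∷ B) (Linked-suffix A (reassociated cyc))

    cyclic-outer : Cyclic (A ++ y ∷ B ++ y ∷ C) → Cyclic (A ++ y ∷ C)
    cyclic-outer cyc = subst (Linked (Edge G)) reshape glued
      where
        l : Linked (Edge G) (A ++ y ∷ B ++ y ∷ (C ++ t))
        l = reassociated cyc
        glued : Linked (Edge G) (A ++ y ∷ (C ++ t))
        glued = Linked-glue A (Linked-prefix A l) (Linked-suffix (y ∷ B) (Linked-suffix A l))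
        reshape : A ++ y ∷ (C ++ t) ≡ (A ++ y ∷ C) ++ take 1 (A ++ y ∷ C)
        reshape = trans (cong (λ z → A ++ y ∷ (C ++ z)) (take-one-++ A (B ++ y ∷ C) C)) (sym (++-assoc A (y ∷ C) _))

    repetition-length : length (A ++ y ∷ B ++ y ∷ C) ≡ length (y ∷ B) + length (A ++ y ∷ C)
    repetition-length
      rewrite length-++ A {y ∷ B ++ y ∷ C} | length-++ B {y ∷ C} | length-++ A {y ∷ C} =
      solve 3 (λ a b c → a :+ (con 1 :+ (b :+ (con 1 :+ c))) := (con 1 :+ b) :+ (a :+ (con 1 :+ c)))
        refl (length A) (length B) (length C)
      where open +-*-Solver

    repetition-shorter : length (y ∷ B) < length (A ++ y ∷ B ++ y ∷ C) × length (A ++ y ∷ C) < length (A ++ y ∷ B ++ y ∷ C)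
    repetition-shorter rewrite repetition-length =
      m<m+n _ (nonempty-length A C) , m<n+m _ (s≤s z≤n)

  -- A repetition-free cyclic list of odd length is a cycle (length 1 would be a loop).
  uniqueOddCyclic⇒cycle : ∀ xs → Unique xs → parity (length xs) ≡ 1ℙ → Cyclic xs → HasCycle G
  uniqueOddCyclic⇒cycle (x ∷ [])         _      _   (e ∷ _) = ⊥-elim (edge-distinct e refl)
  uniqueOddCyclic⇒cycle (x ∷ y ∷ z ∷ xs) unique _   cyc     = x ∷ y ∷ z ∷ xs , s≤s (s≤s (s≤s z≤n)) , unique , cyc

  -- Every cyclic list of odd length contains a cycle: cut at a repeated
  -- vertex and recurse into the odd one of the two shorter pieces.
  oddCyclic⇒cycle : ∀ xs → parity (length xs) ≡ 1ℙ → Cyclic xs → HasCycle G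
  oddCyclic⇒cycle xs = <-rec OddCyclicOfLength shorter (length xs) xs refl
    where
      OddCyclicOfLength : ℕ → Set
      OddCyclicOfLength k = ∀ xs → length xs ≡ k → parity k ≡ 1ℙ → Cyclic xs → HasCycle G

      shorter : ∀ k → (∀ {j} → j < k → OddCyclicOfLength j) → OddCyclicOfLength k
      shorter k ih xs refl odd cyc with unique-or-repetition xs
      ... | inj₁ unique = uniqueOddCyclic⇒cycle xs unique odd cyc
      ... | inj₂ (A , y , B , C , refl)
        with odd-+⁻ (length (y ∷ B)) (length (A ++ y ∷ C)) (trans (cong parity (sym (repetition-length A y B C))) odd)
      ... | inj₁ oddInner = ih (proj₁ (repetition-shorter A y B C)) (y ∷ B) refl oddInner (cyclic-inner A y B C cyc)
      ... | inj₂ oddOuter = ih (proj₂ (repetition-shorter A y B C)) (A ++ y ∷ C) refl oddOuter (cyclic-outer A y B C cyc)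

  acyclic⇒closedWalk-even : (HasCycle G → ⊥) → ∀ {u} (c : Walk u u) → parity (walkLength c) ≢ 1ℙ
  acyclic⇒closedWalk-even acyclic c odd =
    acyclic (oddCyclic⇒cycle (vertices c) (trans (cong parity (vertices-length c)) odd) (closedWalk-cyclic c))

Proper : ∀ {m ℓ} → Graph m → (Fin m → Fin ℓ) → Set
Proper G κ = ∀ u w → Edge G u w → κ u ≢ κ w

parityColour : Parity → Fin 2
parityColour 0ℙ = zero
parityColour 1ℙ = suc zero

parityColour-injective : ∀ p q → parityColour p ≡ parityColour q → p ≡ q
parityColour-injective 0ℙ 0ℙ _ = refl
parityColour-injective 1ℙ 1ℙ _ = refl

odd-+-suc : ∀ a b → parity a ≡ parity b → parity (a + suc b) ≡ 1ℙ
odd-+-suc a b same = begin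
  parity (a + suc b)               ≡⟨ +-homo-+ a (suc b) ⟩
  parity a +ℙ parity (suc b)       ≡⟨ cong₂ _+ℙ_ same (sym (⁻¹-selfInverse (suc-homo-⁻¹ b))) ⟩
  parity b +ℙ (parity b) ⁻¹        ≡⟨ p+p⁻¹≡1ℙ (parity b) ⟩
  1ℙ                               ∎
  where open ≡-Reasoning

-- Colouring each vertex by the parity of a walk from a root is proper in a
-- connected acyclic graph: otherwise an edge closes an odd walk.
tree-2-colouring : ∀ {m} (G : Graph m) → Connected G → (HasCycle G → ⊥) → Fin m →
  Σ (Fin m → Fin 2) (Proper G)
tree-2-colouring {m} G conn acyclic root = colour , proper
  where
    open Walks G
    open OddCycles G
    walkTo : ∀ u → Walk root u
    walkTo = connectingWalk conn root
    colour : Fin m → Fin 2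
    colour u = parityColour (parity (walkLength (walkTo u)))

    proper : Proper G colour
    proper u w e same = acyclic⇒closedWalk-even acyclic closed (begin
      parity (walkLength closed)                                     ≡⟨ cong parity (++ᵂ-length (walkTo u) _) ⟩
      parity (walkLength (walkTo u) + suc (walkLength (reverseᵂ (walkTo w))))
        ≡⟨ cong (λ k → parity (walkLength (walkTo u) + suc k)) (reverseᵂ-length (walkTo w)) ⟩
      parity (walkLength (walkTo u) + suc (walkLength (walkTo w)))
        ≡⟨ odd-+-suc (walkLength (walkTo u)) (walkLength (walkTo w)) (parityColour-injective _ _ same) ⟩
      1ℙ                                                                ∎)
      where
        open ≡-Reasoning
        closed : Walk root root
        closed = walkTo u ++ᵂ step e (reverseᵂ (walkTo w))

classSize : ∀ {m ℓ} → (Fin m → Fin ℓ) → Fin ℓ → ℕ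
classSize κ i = countB (λ u → κ u ≟ᵇ i) (allFin _)

properB-complete : ∀ {m ℓ} (G : Graph m) (κ : Vec (Fin ℓ) m) → Proper G (Vec.lookup κ) → properB G κ ≡ true
properB-complete {m} G κ proper =
  all-intro _ (allFin m) λ u _ → all-intro _ (allFin m) λ w _ → edgeOk u w
  where
    edgeOk : ∀ u w → (not (adj G u w) ∨ not (Vec.lookup κ u ≟ᵇ Vec.lookup κ w)) ≡ true
    edgeOk u w with adj G u w in e
    ... | false = refl
    ... | true rewrite ≟ᵇ-false (proper u w e) = refl

properB-sound : ∀ {m ℓ} (G : Graph m) (κ : Vec (Fin ℓ) m) → properB G κ ≡ true → Proper G (Vec.lookup κ)
properB-sound G κ ok u w e same with all-elim _ (all-elim _ ok (∈-allFin u)) (∈-allFin w)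
... | edgeOk rewrite e | ≟ᵇ-complete same with () ← edgeOk

words-complete : ∀ {A : Set} k (xs : List A) → (∀ x → x ∈ xs) → (κ : Vec A k) → κ ∈ words k xs
words-complete zero    xs every []ᵛ      = here refl
words-complete (suc k) xs every (x ∷ᵛ κ) =
  ∈-concatMap⁺ (λ y → map (y ∷ᵛ_) (words k xs)) (lose (every x) (∈-map⁺ (x ∷ᵛ_) (words-complete k xs every κ)))

countB-toList : ∀ {A : Set} {m} (p : A → Bool) (κ : Vec A m) →
  countB p (toList κ) ≡ countB (λ u → p (Vec.lookup κ u)) (allFin m)
countB-toList p κ = trans (cong (countB p) (toList-tabulate κ)) (countB-tabulate p (Vec.lookup κ))
  where
    toList-tabulate : ∀ {A : Set} {m} (κ : Vec A m) → toList κ ≡ tabulate (Vec.lookup κ)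
    toList-tabulate []ᵛ      = refl
    toList-tabulate (x ∷ᵛ κ) = cong (x ∷_) (toList-tabulate κ)

hasContent₂-intro : ∀ {a b} es → countB (_≟ᵇ zero) es ≡ a → countB (_≟ᵇ suc zero) es ≡ b →
  hasContent (a ∷ b ∷ []) es ≡ true
hasContent₂-intro es zeros ones = ∧-intro (≡ᵇ-complete zeros) (∧-intro (≡ᵇ-complete ones) refl)

hasContent₂-elim : ∀ {a b} es → hasContent (a ∷ b ∷ []) es ≡ true →
  countB (_≟ᵇ zero) es ≡ a × countB (_≟ᵇ suc zero) es ≡ b
hasContent₂-elim {a} {b} es ok =
  ≡ᵇ-sound (∧-conicalˡ zerosOk _ ok) , ≡ᵇ-sound (∧-conicalˡ onesOk true (∧-conicalʳ zerosOk _ ok))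
  where
    zerosOk onesOk : Bool
    zerosOk = countB (_≟ᵇ zero) es ≡ᵇ a
    onesOk  = countB (_≟ᵇ suc zero) es ≡ᵇ b

coeffX-from-colouring : ∀ {m} (G : Graph m) (κ : Fin m → Fin 2) → Proper G κ →
  1 ≤ coeffX G (classSize κ zero ∷ classSize κ (suc zero) ∷ [])
coeffX-from-colouring {m} G κ proper =
  countB-pos _ (words-complete m (allFin 2) ∈-allFin κᵛ)
    (∧-intro (properB-complete G κᵛ properᵛ) (hasContent₂-intro (toList κᵛ) (sizes zero) (sizes (suc zero))))
  where
    κᵛ : Vec (Fin 2) m
    κᵛ = Vec.tabulate κ
    properᵛ : Proper G (Vec.lookup κᵛ)
    properᵛ u w e rewrite lookup∘tabulate κ u | lookup∘tabulate κ w = proper u w e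
    sizes : ∀ i → countB (_≟ᵇ i) (toList κᵛ) ≡ classSize κ i
    sizes i = trans (countB-toList (_≟ᵇ i) κᵛ)
                    (countB-ext _ _ (λ u → cong (_≟ᵇ i) (lookup∘tabulate κ u)) (allFin m))

colouring-from-coeffX : ∀ {m} (G : Graph m) {a b} → 1 ≤ coeffX G (a ∷ b ∷ []) →
  ∃ λ (κ : Fin m → Fin 2) → Proper G κ × classSize κ zero ≡ a × classSize κ (suc zero) ≡ b
colouring-from-coeffX {m} G {a} {b} pos with countB-pos⁻ _ (words m (allFin 2)) pos
... | κᵛ , _ , ok with hasContent₂-elim (toList κᵛ) (∧-conicalʳ (properB G κᵛ) _ ok)
...   | zeros , ones =
  Vec.lookup κᵛ , properB-sound G κᵛ (∧-conicalˡ _ (hasContent (a ∷ b ∷ []) (toList κᵛ)) ok) ,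
  trans (sym (countB-toList (_≟ᵇ zero) κᵛ)) zeros , trans (sym (countB-toList (_≟ᵇ suc zero) κᵛ)) ones

-- Kostka numbers K_{μα} for contents α in two letters: μ must have at
-- most two rows, and the balanced content is then always realised.

fillings-shape : ∀ {ℓ} μ {tab : List (List (Fin ℓ))} → tab ∈ fillings μ → map length tab ≡ μ
fillings-shape []      (here refl) = refl
fillings-shape {ℓ} (k ∷ μ) tab∈
  with r , _ , tab∈rows ← find (∈-concatMap⁻ (λ r → map (toList r ∷_) (fillings μ)) {xs = words k (allFin ℓ)} tab∈)
  with tab′ , tab′∈ , refl ← ∈-map⁻ (toList r ∷_) tab∈rows
  = cong₂ _∷_ (length-toList r) (fillings-shape μ tab′∈)

fillings-complete : ∀ {ℓ} (tab : List (List (Fin ℓ))) → tab ∈ fillings (map length tab)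
fillings-complete []            = here refl
fillings-complete {ℓ} (r ∷ tab) =
  ∈-concatMap⁺ (λ r → map (toList r ∷_) (fillings (map length tab)))
    (lose (words-complete (length r) (allFin ℓ) ∈-allFin (Vec.fromList r))
      (subst (λ r′ → r ∷ tab ∈ map (r′ ∷_) (fillings (map length tab))) (sym (toList∘fromList r))
        (∈-map⁺ (r ∷_) (fillings-complete tab))))

kostka-witness : ∀ μ α (tab : List (List (Fin (length α)))) → map length tab ≡ μ →
  isSSYT tab ≡ true → hasContent α (concat tab) ≡ true → 1 ≤ kostka μ α
kostka-witness μ α tab shape ssyt content =
  countB-pos _ (subst (λ ν → tab ∈ fillings ν) shape (fillings-complete tab)) (∧-intro ssyt content)

block : ℕ → ℕ → List (Fin 2)
block a b = replicate a zero ++ replicate b (suc zero)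

block-length : ∀ a b → length (block a b) ≡ a + b
block-length a b = trans (length-++ (replicate a zero)) (cong₂ _+_ (length-replicate a) (length-replicate b))

block-zeros : ∀ a b → countB (_≟ᵇ zero) (block a b) ≡ a
block-zeros a b = begin
  countB (_≟ᵇ zero) (block a b)  ≡⟨ countB-++ (_≟ᵇ zero) (replicate a zero) _ ⟩
  _                              ≡⟨ cong₂ _+_ (countB-replicate-true (_≟ᵇ zero) refl a)
                                              (countB-replicate-false (_≟ᵇ zero) refl b) ⟩
  a + 0                          ≡⟨ +-identityʳ a ⟩
  a                              ∎
  where open ≡-Reasoning

block-ones : ∀ a b → countB (_≟ᵇ suc zero) (block a b) ≡ b
block-ones a b = trans (countB-++ (_≟ᵇ suc zero) (replicate a zero) _)
  (cong₂ _+_ (countB-replicate-false (_≟ᵇ suc zero) refl a) (countB-replicate-true (_≟ᵇ suc zero) refl b))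

block-rowWeak : ∀ a b → rowWeak (block a b) ≡ true
block-rowWeak (suc (suc a)) b       = block-rowWeak (suc a) b
block-rowWeak (suc zero)    zero    = refl
block-rowWeak (suc zero)    (suc b) = block-rowWeak zero (suc b)
block-rowWeak zero          zero    = refl
block-rowWeak zero          (suc zero)    = refl
block-rowWeak zero          (suc (suc b)) = block-rowWeak zero (suc b)

block-colStrict : ∀ a k q → q ≤ a → colStrict (block a k ∷ block 0 q ∷ []) ≡ true
block-colStrict a       k zero    _         = ∧-intro (noPairs (block a k)) refl
  where
    noPairs : ∀ (r : List (Fin 2)) → all _ (zip r []) ≡ true
    noPairs []      = refl
    noPairs (_ ∷ _) = refl
block-colStrict (suc a) k (suc q) (s≤s q≤a) = block-colStrict a k q q≤a

countB-concat-oneRow : ∀ {A : Set} (p : A → Bool) r → countB p (concat (r ∷ [])) ≡ countB p r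
countB-concat-oneRow p r = cong (countB p) (++-identityʳ r)

countB-concat-twoRows : ∀ {A : Set} (p : A → Bool) r s → countB p (concat (r ∷ s ∷ [])) ≡ countB p r + countB p s
countB-concat-twoRows p r s = trans (countB-++ p r (s ++ [])) (cong (countB p r +_) (countB-concat-oneRow p s))

kostka-oneRow : ∀ a b → 1 ≤ kostka (a + b ∷ []) (a ∷ b ∷ [])
kostka-oneRow a b = kostka-witness _ (a ∷ b ∷ []) (block a b ∷ []) (cong (_∷ []) (block-length a b))
  (∧-intro (∧-intro (block-rowWeak a b) refl) refl)
  (hasContent₂-intro (concat (block a b ∷ []))
    (trans (countB-concat-oneRow (_≟ᵇ zero) (block a b)) (block-zeros a b))
    (trans (countB-concat-oneRow (_≟ᵇ suc zero) (block a b)) (block-ones a b)))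

kostka-twoRows : ∀ a k q → q ≤ a → 1 ≤ kostka (a + k ∷ q ∷ []) (a ∷ k + q ∷ [])
kostka-twoRows a k q q≤a = kostka-witness _ (a ∷ k + q ∷ []) (block a k ∷ block 0 q ∷ [])
  (cong₂ _∷_ (block-length a k) (cong (_∷ []) (block-length 0 q)))
  (∧-intro (∧-intro (block-rowWeak a k) (∧-intro (block-rowWeak 0 q) refl)) (block-colStrict a k q q≤a))
  (hasContent₂-intro (concat (block a k ∷ block 0 q ∷ []))
    (trans (countB-concat-twoRows (_≟ᵇ zero) (block a k) (block 0 q))
           (trans (cong₂ _+_ (block-zeros a k) (block-zeros 0 q)) (+-identityʳ a)))
    (trans (countB-concat-twoRows (_≟ᵇ suc zero) (block a k) (block 0 q))
           (cong₂ _+_ (block-ones a k) (block-ones 0 q))))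

-- Two letters cannot strictly increase down a column of height three.
no-three-rows : ∀ (tab : List (List (Fin 2))) {p q r rest} → colStrict tab ≡ true →
  map length tab ≡ p ∷ q ∷ r ∷ rest → 1 ≤ p → 1 ≤ q → 1 ≤ r → ⊥
no-three-rows ((a ∷ r₁) ∷ (b ∷ r₂) ∷ (c ∷ r₃) ∷ _) strict refl _ _ _ =
  increasing-triple a b c (∧-conicalˡ _ _ (∧-conicalˡ _ _ strict))
                          (∧-conicalˡ _ _ (∧-conicalˡ _ _ (∧-conicalʳ ((toℕ a <ᵇ toℕ b) ∧ _) _ strict)))
  where
    increasing-triple : (a b c : Fin 2) → (toℕ a <ᵇ toℕ b) ≡ true → (toℕ b <ᵇ toℕ c) ≡ true → ⊥
    increasing-triple zero       zero       _          () _
    increasing-triple zero       (suc zero) zero       _  ()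
    increasing-triple zero       (suc zero) (suc zero) _  ()
    increasing-triple (suc zero) zero       _          () _
    increasing-triple (suc zero) (suc zero) _          () _
no-three-rows ([] ∷ _ ∷ _ ∷ _)                  _ refl () _ _
no-three-rows ((_ ∷ _) ∷ [] ∷ _ ∷ _)            _ refl _ () _
no-three-rows ((_ ∷ _) ∷ (_ ∷ _) ∷ [] ∷ _)      _ refl _ _ ()

partition-spec : ∀ {N μ} → μ ∈ partitions N →
  weaklyDecr μ ≡ true × all (λ k → 1 ≤ᵇ k) μ ≡ true × sum μ ≡ N
partition-spec {N} {μ} μ∈ with proj₂ (∈-filter⁻ (λ ν → IsPartitionOfB N ν ≟𝔹 true)
                                                {xs = listsUpTo N (applyUpTo suc N)} μ∈)
... | spec = ∧-conicalˡ decr _ spec , ∧-conicalˡ pos total (∧-conicalʳ decr _ spec)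
           , ≡ᵇ-sound (∧-conicalʳ pos total (∧-conicalʳ decr _ spec))
  where
    decr pos total : Bool
    decr  = weaklyDecr μ
    pos   = all (λ k → 1 ≤ᵇ k) μ
    total = sum μ ≡ᵇ N

balanced-split : ∀ {n p q} → q ≤ p → p + q ≡ n + n → n ≤ p × q ≤ n
balanced-split {n} {p} {q} q≤p sum≡ = n≤p , q≤n
  where
    n≤p : n ≤ p
    n≤p with n ≤? p
    ... | yes le = le
    ... | no n≰p = ⊥-elim (<-irrefl sum≡ (≤-<-trans (+-monoʳ-≤ p q≤p) (+-mono-< (≰⇒> n≰p) (≰⇒> n≰p))))
    q≤n : q ≤ n
    q≤n with q ≤? n
    ... | yes le = le
    ... | no q≰n = ⊥-elim (<-irrefl (sym sum≡) (<-≤-trans (+-mono-< (≰⇒> q≰n) (≰⇒> q≰n)) (+-monoˡ-≤ q q≤p)))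

kostka-balanced : ∀ n μ {a b} → μ ∈ partitions (n + n) → 1 ≤ kostka μ (a ∷ b ∷ []) → 1 ≤ kostka μ (n ∷ n ∷ [])
kostka-balanced n μ μ∈ pos with partition-spec {n + n} μ∈
kostka-balanced n [] _ _ | _ , _ , total rewrite m+n≡0⇒m≡0 n (sym total) = s≤s z≤n
kostka-balanced n (p ∷ []) _ _ | _ , _ , total =
  subst (λ p′ → 1 ≤ kostka (p′ ∷ []) (n ∷ n ∷ [])) (trans (sym total) (+-identityʳ p)) (kostka-oneRow n n)
kostka-balanced n (p ∷ q ∷ []) _ _ | decr , _ , total =
  subst₂ (λ p′ n′ → 1 ≤ kostka (p′ ∷ q ∷ []) (n ∷ n′ ∷ [])) (m+[n∸m]≡n n≤p) rest≡n (kostka-twoRows n (p ∸ n) q q≤n)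
  where
    p+q≡2n : p + q ≡ n + n
    p+q≡2n = trans (cong (p +_) (sym (+-identityʳ q))) total
    bounds : n ≤ p × q ≤ n
    bounds = balanced-split (≤ᵇ-sound (∧-conicalˡ (q ≤ᵇ p) true decr)) p+q≡2n
    n≤p : n ≤ p
    n≤p = proj₁ bounds
    q≤n : q ≤ n
    q≤n = proj₂ bounds
    rest≡n : p ∸ n + q ≡ n
    rest≡n = +-cancelˡ-≡ n _ _ (trans (sym (+-assoc n (p ∸ n) q)) (trans (cong (_+ q) (m+[n∸m]≡n n≤p)) p+q≡2n))
kostka-balanced n (p ∷ q ∷ r ∷ rest) _ pos | _ , positive , _
  with tab , tab∈ , ok ← countB-pos⁻ _ (fillings (p ∷ q ∷ r ∷ rest)) pos =
  ⊥-elim (no-three-rows tab {p} {q} {r} {rest} (∧-conicalʳ (all rowWeak tab) _ (∧-conicalˡ _ _ ok))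
           (fillings-shape _ tab∈) (part (here refl)) (part (there (here refl))) (part (there (there (here refl)))))
  where
    part : ∀ {k} → k ∈ p ∷ q ∷ r ∷ rest → 1 ≤ k
    part k∈ = ≤ᵇ-sound (all-elim (λ k → 1 ≤ᵇ k) {xs = p ∷ q ∷ r ∷ rest} positive k∈)

-- If X_G = Σ c_μ s_μ with c_μ ≥ 0, a nonzero coefficient of x^α forces
-- c_μ > 0 for some μ with K_{μα} > 0; so x^β has a nonzero coefficient
-- whenever K_{μβ} > 0 follows from K_{μα} > 0.
schurPositive-transfer : ∀ {m} (G : Graph m) α β → SchurPositive G →
  (∀ μ → μ ∈ partitions m → 1 ≤ kostka μ α → 1 ≤ kostka μ β) → 1 ≤ coeffX G α → 1 ≤ coeffX G β
schurPositive-transfer {m} G α β (c , expansion) support pos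
  with μ , μ∈ , term ← sum-pos⁻ (λ μ → c μ * kostka μ α) (partitions m) (subst (1 ≤_) (expansion α) pos)
  with cμ , kμ ← *-pos⁻ (c μ) (kostka μ α) term =
  subst (1 ≤_) (sym (expansion β))
    (sum-pos (λ μ → c μ * kostka μ β) (partitions m) μ∈ (*-mono-≤ cμ (support μ μ∈ kμ)))

opposite : Fin 2 → Fin 2
opposite zero       = suc zero
opposite (suc zero) = zero

two-colours : ∀ (c d : Fin 2) → c ≢ d → d ≡ opposite c
two-colours zero       zero       c≢d = ⊥-elim (c≢d refl)
two-colours zero       (suc zero) _   = refl
two-colours (suc zero) zero       _   = refl
two-colours (suc zero) (suc zero) c≢d = ⊥-elim (c≢d refl)

-- Every neighbour of v has the opposite colour; if there are exactly as
-- many neighbours as vertices of that colour, v is adjacent to all of them.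
saturated-neighbourhood : ∀ {m} (G : Graph m) (κ : Fin m → Fin 2) → Proper G κ →
  ∀ v → degree G v ≡ classSize κ (opposite (κ v)) → ∀ u → κ u ≢ κ v → Edge G v u
saturated-neighbourhood {m} G κ proper v deg u differ =
  countB-≡-converse (adj G v) (λ w → κ w ≟ᵇ opposite (κ v)) neighbourOpposite (allFin m) deg (∈-allFin u)
    (≟ᵇ-complete (two-colours (κ v) (κ u) (λ same → differ (sym same))))
  where
    neighbourOpposite : ∀ w → Edge G v w → (κ w ≟ᵇ opposite (κ v)) ≡ true
    neighbourOpposite w e = ≟ᵇ-complete (two-colours (κ v) (κ w) (proper v w e))

-- In an acyclic graph, a vertex x ≠ v whose neighbours are all neighbours
-- of v has at most one neighbour: two of them, y ≠ z, close the cycle v y x z.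
acyclic-shared-neighbours : ∀ {m} (G : Graph m) → (HasCycle G → ⊥) → ∀ {v x} → x ≢ v →
  (∀ y → Edge G x y → Edge G v y) → ∀ {y z} → Edge G x y → Edge G x z → z ≡ y
acyclic-shared-neighbours G acyclic {v} {x} x≢v shared {y} {z} x∼y x∼z with z ≟F y
... | yes z≡y = z≡y
... | no z≢y  = ⊥-elim (acyclic (v ∷ y ∷ x ∷ z ∷ [] , s≤s (s≤s (s≤s z≤n)) , distinct , linked))
  where
    open Walks G using (edge-sym; edge-distinct)
    v∼y : Edge G v y
    v∼y = shared y x∼y
    v∼z : Edge G v z
    v∼z = shared z x∼z
    distinct : Unique (v ∷ y ∷ x ∷ z ∷ [])
    distinct = (edge-distinct v∼y ∷ (λ v≡x → x≢v (sym v≡x)) ∷ edge-distinct v∼z ∷ [])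
             ∷ ((λ y≡x → edge-distinct x∼y (sym y≡x)) ∷ (λ y≡z → z≢y (sym y≡z)) ∷ [])
             ∷ (edge-distinct x∼z ∷ [])
             ∷ [] ∷ []
    linked : Linked (Edge G) (v ∷ y ∷ x ∷ z ∷ v ∷ [])
    linked = v∼y ∷ edge-sym x∼y ∷ x∼z ∷ edge-sym v∼z ∷ [-]

unique-neighbour⇒leaf : ∀ {m} (G : Graph m) {x y} → Edge G x y → (∀ z → Edge G x z → z ≡ y) → IsLeaf G x
unique-neighbour⇒leaf G {x} {y} x∼y only = countB-exactlyOne (adj G x) y only x∼y

-- Such a vertex
-- has the colour of v, so all its neighbours are neighbours of v, and by
-- acyclicity it has only one of them.
saturated-tree-leaf : ∀ {m} (T : Graph m) → IsTree T → (κ : Fin m → Fin 2) → Proper T κ →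
  ∀ v → degree T v ≡ classSize κ (opposite (κ v)) →
  ∀ x → x ≢ v → adj T v x ≡ false → IsLeaf T x
saturated-tree-leaf T (conn , acyclic) κ proper v deg x x≢v v≁x
  with y , x∼y ← Walks.connected-neighbour T conn x≢v =
  unique-neighbour⇒leaf T x∼y (λ z x∼z → acyclic-shared-neighbours T acyclic x≢v sharedNeighbour x∼y x∼z)
  where
    adjacentToOpposite : ∀ u → κ u ≢ κ v → Edge T v u
    adjacentToOpposite = saturated-neighbourhood T κ proper v deg

    sameColour : κ x ≡ κ v
    sameColour with κ x ≟F κ v
    ... | yes same = same
    ... | no differ with () ← trans (sym v≁x) (adjacentToOpposite x differ)

    sharedNeighbour : ∀ w → Edge T x w → Edge T v w
    sharedNeighbour w x∼w = adjacentToOpposite w (λ same → proper x w x∼w (trans sameColour (sym same)))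

-- A tree on 2n vertices with Schur-positive X_T has a proper 2-colouring
-- with both colour classes of size n: being bipartite, X_T has a nonzero
-- coefficient at some x₁^a x₂^b, and Schur positivity moves it to x₁^n x₂^n.
schurPositive-tree-balanced : ∀ n (T : Graph (n + n)) → IsTree T → Fin (n + n) → SchurPositive T →
  ∃ λ (κ : Fin (n + n) → Fin 2) → Proper T κ × (∀ i → classSize κ i ≡ n)
schurPositive-tree-balanced n T (conn , acyclic) root schur = balanced (colouring-from-coeffX T balancedCoeff)
  where
    κ₀ : Fin (n + n) → Fin 2
    κ₀ = proj₁ (tree-2-colouring T conn acyclic root)

    sizes₀ : List ℕ
    sizes₀ = classSize κ₀ zero ∷ classSize κ₀ (suc zero) ∷ []

    bipartiteCoeff : 1 ≤ coeffX T sizes₀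
    bipartiteCoeff = coeffX-from-colouring T κ₀ (proj₂ (tree-2-colouring T conn acyclic root))

    balancedCoeff : 1 ≤ coeffX T (n ∷ n ∷ [])
    balancedCoeff = schurPositive-transfer T sizes₀ (n ∷ n ∷ []) schur (λ μ μ∈ → kostka-balanced n μ μ∈) bipartiteCoeff

    balanced : (∃ λ (κ : Fin (n + n) → Fin 2) → Proper T κ × classSize κ zero ≡ n × classSize κ (suc zero) ≡ n) →
      ∃ λ (κ : Fin (n + n) → Fin 2) → Proper T κ × (∀ i → classSize κ i ≡ n)
    balanced (κ , proper , zeros , ones) = κ , proper , λ { zero → zeros ; (suc zero) → ones }

-- The degree hypothesis says v has as many neighbours as the class opposite
-- to it in the balanced colouring.
corollary3 : (n : ℕ) → 1 ≤ n → (T : Graph (n + n)) → IsTree T →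
    (v : Fin (n + n)) → degree T v ≡ n → SchurPositive T →
    (x : Fin (n + n)) → x ≢ v → adj T v x ≡ false → IsLeaf T x
corollary3 n _ T tree v deg schur =
  let κ , proper , classSize≡n = schurPositive-tree-balanced n T tree v schur
  in  saturated-tree-leaf T tree κ proper v (trans deg (sym (classSize≡n (opposite (κ v)))))
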